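{- Let $\mathbf{M}=(M;\leq,0,1)$ be a non-trivial complete lattice, let $S$ be a non-empty set, and let $\mathbf{B}$ be a bounded subposet of $\mathbf{M}^{S}$. Let $(\wp(S\times S);\subseteq)$ be the poset of all relations on $S$, and let $\mathrm{Map}_1(\mathbf{B},\mathbf{M}^S)$ be the set of all order-preserving mappings $T\colon B\to M^S$ with $T(1)=1$, ordered by $T_1\sqsubseteq T_2$ if and only if $T_2(b)\leq T_1(b)$ for all $b\in B$. Define $\varphi(R)=T_R$ for $R\in\wp(S\times S)$ and $\psi(T)=R_T$ for $T\in \mathrm{Map}_1(\mathbf{B},\mathbf{M}^S)$. Then $(\varphi,\psi)$ is a Galois connection between $(\wp(S\times S);\subseteq)$ and $(\mathrm{Map}_1(\mathbf{B},\mathbf{M}^S);\sqsubseteq)$, i.e., $\varphi$ and $\psi$ are maps between these posets and for all $R$ and $T$: $\varphi(R)\sqsubseteq T$ if and only if $R\subseteq\psi(T)$.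
   Context: Non-trivial means $0\neq 1$. $\mathbf{M}^S$ is ordered componentwise; a bounded subposet of $\mathbf{M}^S$ is a subset containing the constant tuples $0$ and $1$ with the inherited order. For $s\in S$ and $m\in M^S$, $s(m)$ denotes the $s$-th component of $m$. For $R\subseteq S\times S$ (writing $sRt$ for $(s,t)\in R$), $T_R\colon B\to M^S$ is defined by $T_R(b)(s)=\bigwedge_M\{t(b)\mid sRt\}$ (the empty meet being $1$). For $T\colon B\to M^S$, $R_T=\{(s,t)\in S\times S\mid \forall b\in B:\ s(T(b))\leq t(b)\}$. -}

module Defs where

open import Level using (0ℓ)
open import Data.Empty using (⊥)
open import Data.Product using (Σ; _×_; _,_)
open import Relation.Nullary using (¬_)
open import Relation.Unary using (Pred; _∈_)
open import Relation.Binary using (Poset; Rel)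

-- A complete lattice: a poset (in Set) with infima of all families indexed
-- by (small) types.  Arbitrary joins, 0 and 1 are derivable from these.
record CompleteLattice : Set₁ where
  field
    poset : Poset 0ℓ 0ℓ 0ℓ
  open Poset poset public
  field
    ⋀          : {I : Set} → (I → Carrier) → Carrier
    ⋀-lower    : {I : Set} (f : I → Carrier) (i : I) → ⋀ f ≤ f i
    ⋀-greatest : {I : Set} (f : I → Carrier) (x : Carrier) →
                 ((i : I) → x ≤ f i) → x ≤ ⋀ f

  𝟏 : Carrier
  𝟏 = ⋀ {⊥} (λ ())

  𝟎 : Carrier
  𝟎 = ⋀ {Carrier} (λ x → x)

module _ (M : CompleteLattice) where
  open CompleteLattice M

  NonTrivial : Set
  NonTrivial = ¬ (𝟎 ≈ 𝟏)

  module _ (S : Set) where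

    Tuple : Set
    Tuple = S → Carrier

    _≤ᵗ_ : Tuple → Tuple → Set
    m ≤ᵗ n = (s : S) → m s ≤ n s

    _≈ᵗ_ : Tuple → Tuple → Set
    m ≈ᵗ n = (s : S) → m s ≈ n s

    𝟎ᵗ : Tuple
    𝟎ᵗ = λ _ → 𝟎

    𝟏ᵗ : Tuple
    𝟏ᵗ = λ _ → 𝟏

    BoundedSubposet : Pred Tuple 0ℓ → Set
    BoundedSubposet B = (𝟎ᵗ ∈ B) × (𝟏ᵗ ∈ B)

    module _ (B : Pred Tuple 0ℓ) where

      Map : Set
      Map = (b : Tuple) → b ∈ B → Tuple

      OrderPreserving : Map → Set
      OrderPreserving T = (b b′ : Tuple) (p : b ∈ B) (p′ : b′ ∈ B) →
                          b ≤ᵗ b′ → T b p ≤ᵗ T b′ p′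

      InMap₁ : Map → Set
      InMap₁ T = OrderPreserving T × ((p : 𝟏ᵗ ∈ B) → T 𝟏ᵗ p ≈ᵗ 𝟏ᵗ)

      _⊑_ : Map → Map → Set
      T₁ ⊑ T₂ = (b : Tuple) (p : b ∈ B) → T₂ b p ≤ᵗ T₁ b p

      T[_] : Rel S 0ℓ → Map
      T[ R ] b _ s = ⋀ {Σ S (λ t → R s t)} (λ { (t , _) → b t })

      R[_] : Map → Rel S 0ℓ
      R[ T ] s t = (b : Tuple) (p : b ∈ B) → T b p s ≤ b t

module Submission where

-- Everything follows from the defining property of meets applied to
-- T_R(b)(s) = ⋀ { b(t) | s R t }: it is below each b(t) with s R t, and
-- any common lower bound of these b(t) is below it.  The two halves
-- of the Galois condition are then one-line consequences of the lower-bound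
-- and greatest-lower-bound properties of ⋀:
--   T_R ⊑ T  ⇒  R ⊆ R_T   (chain T(b)(s) ≤ T_R(b)(s) ≤ b(t) for s R t),
--   R ⊆ R_T  ⇒  T_R ⊑ T   (T(b)(s) is a lower bound of { b(t) | s R t }).

open import Defs
open import Data.Product using (_×_; _,_; Σ)
open import Relation.Unary using (Pred; _∈_)
open import Relation.Binary using (Rel; _⇒_)
open import Level using (0ℓ)

module LatticeFacts (M : CompleteLattice) where
  open CompleteLattice M

  ⋀-mono : {I : Set} (f g : I → Carrier) → ((i : I) → f i ≤ g i) → ⋀ f ≤ ⋀ g
  ⋀-mono f g f≤g = ⋀-greatest g (⋀ f) (λ i → trans (⋀-lower f i) (f≤g i))

  ≤-𝟏 : (x : Carrier) → x ≤ 𝟏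
  ≤-𝟏 x = ⋀-greatest _ x (λ ())

  ⋀-const-𝟏 : (I : Set) → ⋀ {I} (λ _ → 𝟏) ≈ 𝟏
  ⋀-const-𝟏 I = antisym (≤-𝟏 _) (⋀-greatest _ 𝟏 (λ _ → refl))

module GaloisConnection (M : CompleteLattice) (S : Set) (B : Pred (Tuple M S) 0ℓ) where
  open CompleteLattice M
  open LatticeFacts M

  T-orderPreserving : (R : Rel S 0ℓ) → OrderPreserving M S B (T[_] M S B R)
  T-orderPreserving R b b′ _ _ b≤b′ s =
    ⋀-mono (λ { (t , _) → b t }) (λ { (t , _) → b′ t }) (λ { (t , _) → b≤b′ t })

  T-preservesTop : (R : Rel S 0ℓ) (p : 𝟏ᵗ M S ∈ B) → _≈ᵗ_ M S (T[_] M S B R (𝟏ᵗ M S) p) (𝟏ᵗ M S)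
  T-preservesTop R p s = ⋀-const-𝟏 (Σ S (R s))

  T-inMap₁ : (R : Rel S 0ℓ) → InMap₁ M S B (T[_] M S B R)
  T-inMap₁ R = T-orderPreserving R , T-preservesTop R

  ⊑⇒⊆ : (R : Rel S 0ℓ) (T : Map M S B) → _⊑_ M S B (T[_] M S B R) T → R ⇒ R[_] M S B T
  ⊑⇒⊆ R T T_R⊑T {s} {t} sRt b p = trans (T_R⊑T b p s) (⋀-lower _ (t , sRt))

  ⊆⇒⊑ : (R : Rel S 0ℓ) (T : Map M S B) → R ⇒ R[_] M S B T → _⊑_ M S B (T[_] M S B R) T
  ⊆⇒⊑ R T R⊆R_T b p s = ⋀-greatest _ (T b p s) (λ { (t , sRt) → R⊆R_T sRt b p })

theorem2p2 : (M : CompleteLattice) → NonTrivial M →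
    (S : Set) → S →
    (B : Pred (Tuple M S) 0ℓ) → BoundedSubposet M S B →
    ((R : Rel S 0ℓ) → InMap₁ M S B (T[_] M S B R)) ×
    ((R : Rel S 0ℓ) (T : Map M S B) → InMap₁ M S B T →
    (_⊑_ M S B (T[_] M S B R) T → R ⇒ R[_] M S B T) ×
    (R ⇒ R[_] M S B T → _⊑_ M S B (T[_] M S B R) T))
theorem2p2 M _ S _ B _ = T-inMap₁ , λ R T _ → ⊑⇒⊆ R T , ⊆⇒⊑ R T
  where open GaloisConnection M S B
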